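{- Let $\lambda$ be a partition and $n$ a positive integer. If $T\in\mathrm{SVRPP}^n(\lambda)$ is a highest weight element with $\mathrm{ircont}(T)=\rho$, then $(\lambda_1)\subseteq\rho\subseteq\bar\lambda^{(n)}$.
   Context: Boxes are $(i,j)$ (row $i$, column $j$); $\rho\subseteq\nu$ means $\rho_i\le\nu_i$ for all $i$; $(\lambda_1)$ is the one-part partition. $\mathrm{SVRPP}^n(\lambda)$: fillings $T$ of the Young diagram of $\lambda$ by nonempty subsets $T(i,j)\subseteq[n]$ weakly increasing along rows and down columns ($A\le B$ meaning $\max A\le\min B$); $\mathrm{ircont}(T)=(r_1,\ldots,r_n)$, $r_k$ = number of columns containing a box whose set contains $k$. Highest weight: for $m\in[n-1]$, restrict $T$ to the boxes whose set meets $\{m,m+1\}$; a nonempty column of this restriction is $m$-pure if each of its boxes meets $\{m,m+1\}$ in exactly $\{m\}$, $(m+1)$-pure if exactly $\{m+1\}$, mixed otherwise; the $m$-signature lists, columns left to right, $+$ for $m$-pure and $-$ for $(m+1)$-pure columns; repeatedly cancel a $-$ immediately followed by a $+$. $T$ is highest weight if for every $m$ no $-$ survives. Define $\lambda^\flat$ by $\lambda^\flat_1=\lambda_1$ and $\lambda^\flat_i=\max\{0,\min\{\lambda^\flat_{i-1}-1,\lambda_i\}\}$ for $i\ge2$; let $k$ be its number of positive parts. $\bar\lambda^{(n)}=(\bar\lambda^{(n)}_1,\ldots,\bar\lambda^{(n)}_n)$: if $n\le k$, $\bar\lambda^{(n)}_i=\lambda^\flat_i+i-1$ for $i\le n$;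 if $n>k$, $\bar\lambda^{(n)}_i=\lambda^\flat_i+i-1$ for $i\le k$ and $\bar\lambda^{(n)}_i=k$ for $k<i\le n$. -}

module Defs where

open import Data.Nat using (ℕ; zero; suc; _+_; _∸_; _≤_; _<_; _⊓_; _≤ᵇ_; _<ᵇ_)
open import Data.Bool using (Bool; true; false; _∧_; _∨_; not; if_then_else_)
open import Data.List using (List; []; _∷_; length; map; upTo; mapMaybe)
open import Data.Bool.ListAction using (any; all)
open import Data.List.Relation.Unary.All using (All)
open import Data.List.Relation.Unary.Linked using (Linked)
open import Data.Maybe using (Maybe; just; nothing)
open import Data.Vec using (Vec; []; _∷_)
open import Data.Fin.Subset using (Subset)
open import Data.Product using (_×_; ∃)
open import Relation.Binary.PropositionalEquality using (_≡_)

IsPartition : List ℕ → Set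
IsPartition la = Linked (λ a b → b ≤ a) la × All (λ a → 0 < a) la

-- part la i = la_i, 1-based (row 0 and rows beyond the length give 0).
part : List ℕ → ℕ → ℕ
part []       _               = 0
part (x ∷ xs) zero            = 0
part (x ∷ xs) (suc zero)      = x
part (x ∷ xs) (suc (suc i))   = part xs (suc i)

range1 : ℕ → List ℕ
range1 m = map suc (upTo m)

countᵇ : (ℕ → Bool) → List ℕ → ℕ
countᵇ p []       = 0
countᵇ p (x ∷ xs) = (if p x then 1 else 0) + countᵇ p xs

-- Subsets of [n] = {1,…,n}: element k (1-based) corresponds to position k-1.
has : ∀ {n} → Subset n → ℕ → Bool
has []       _             = false
has (b ∷ S)  zero          = false
has (b ∷ S)  (suc zero)    = b
has (b ∷ S)  (suc (suc k)) = has S (suc k)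

NonemptySet : ∀ {n} → Subset n → Set
NonemptySet S = ∃ λ k → has S k ≡ true

-- A ≤ B  iff  max A ≤ min B
_≤set_ : ∀ {n} → Subset n → Subset n → Set
A ≤set B = ∀ a b → has A a ≡ true → has B b ≡ true → a ≤ b

InDiag : List ℕ → ℕ → ℕ → Set
InDiag la i j = 1 ≤ i × 1 ≤ j × j ≤ part la i

Filling : ℕ → Set
Filling n = ℕ → ℕ → Subset n

-- T ∈ SVRPP^n(la)  (values of T outside the diagram are irrelevant)
IsSVRPP : (n : ℕ) → List ℕ → Filling n → Set
IsSVRPP n la T =
  (∀ i j → InDiag la i j → NonemptySet (T i j)) ×
  (∀ i j → InDiag la i j → InDiag la i (suc j) → T i j ≤set T i (suc j)) ×
  (∀ i j → InDiag la i j → InDiag la (suc i) j → T i j ≤set T (suc i) j)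

colRows : List ℕ → ℕ → List ℕ
colRows la j = Data.List.filterᵇ (λ i → j ≤ᵇ part la i) (range1 (length la))
  where import Data.List

ircont : (n : ℕ) → List ℕ → Filling n → ℕ → ℕ
ircont n la T k =
  countᵇ (λ j → any (λ i → has (T i j) k) (colRows la j)) (range1 (part la 1))

data Sign : Set where
  plus minus : Sign

colSign : (n : ℕ) → List ℕ → Filling n → ℕ → ℕ → Maybe Sign
colSign n la T m j =
  let rs   = Data.List.filterᵇ (λ i → has (T i j) m ∨ has (T i j) (suc m)) (colRows la j)
      mPure  = all (λ i → has (T i j) m ∧ not (has (T i j) (suc m))) rs
      m1Pure = all (λ i → not (has (T i j) m) ∧ has (T i j) (suc m)) rs
  in go rs mPure m1Pure
  where
  import Data.List
  go : List ℕ → Bool → Bool → Maybe Sign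
  go [] _ _           = nothing
  go (_ ∷ _) true _   = just plus
  go (_ ∷ _) false true  = just minus
  go (_ ∷ _) false false = nothing

signature : (n : ℕ) → List ℕ → Filling n → ℕ → List Sign
signature n la T m = mapMaybe (colSign n la T m) (range1 (part la 1))

cancel1 : List Sign → List Sign
cancel1 []                   = []
cancel1 (minus ∷ plus ∷ xs)  = xs
cancel1 (x ∷ xs)             = x ∷ cancel1 xs

-- repeat cancellation (length w iterations always suffice to stabilise)
reduceSig : List Sign → List Sign
reduceSig w = go (length w) w
  where
  go : ℕ → List Sign → List Sign
  go zero    w = w
  go (suc k) w = go k (cancel1 w)

NoMinus : List Sign → Set
NoMinus w = All (λ s → s ≡ plus) w

HighestWeight : (n : ℕ) → List ℕ → Filling n → Set
HighestWeight n la T = ∀ m → 1 ≤ m → m < n → NoMinus (reduceSig (signature n la T m))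

flat : List ℕ → ℕ → ℕ
flat la zero          = 0
flat la (suc zero)    = part la 1
flat la (suc (suc i)) = (flat la (suc i) ∸ 1) ⊓ part la (suc (suc i))

-- number of positive parts of la♭ (they vanish beyond the length of la)
kflat : List ℕ → ℕ
kflat la = countᵇ (λ i → 0 <ᵇ flat la i) (range1 (length la))

barλ : ℕ → List ℕ → ℕ → ℕ
barλ n la i =
  if (1 ≤ᵇ i) ∧ (i ≤ᵇ n)
  then (if n ≤ᵇ kflat la
        then flat la i + (i ∸ 1)
        else (if i ≤ᵇ kflat la then flat la i + (i ∸ 1) else kflat la))
  else 0

oneRow : List ℕ → ℕ → ℕ
oneRow la (suc zero) = part la 1
oneRow la _          = 0

_⊆ₚ_ : (ℕ → ℕ) → (ℕ → ℕ) → Set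
ρ ⊆ₚ ν = ∀ i → ρ i ≤ ν i

{-# OPTIONS --safe #-}
-- Highest weight says that no suffix of an m-signature has more − signs than + signs.
-- Column by column this yields a ballot property of the content: to the right of
-- any column, at most as many columns contain m+1 as contain m.  Two consequences follow
-- from the strict increase of T along rows and columns.  Every column contains 1, so
-- ρ₁ = λ₁.  An entry i in row s of column c has s > min (i − 1, k), k the number of columns
-- right of c containing i (induction on i); hence for r ≤ i at most r − 1 columns beyond
-- λᵣ contain i, i.e. ρᵢ ≤ λᵣ + r − 1, and λ̄⁽ⁿ⁾ᵢ dominates the least of these bounds.
module Submission where

open import Defs
open import Data.Nat using (ℕ; _≤_)
open import Data.List using (List)
open import Data.Product using (_×_)

open import Data.Bool using (Bool; true; false; T; T?; _∧_; _∨_; not; if_then_else_)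
open import Data.Bool.ListAction using (any; all)
open import Data.Bool.Properties using (T-≡; T-∧; T-∨)
open import Data.Empty using (⊥-elim)
open import Data.Fin.Subset using (Subset)
open import Data.Vec using ([]; _∷_)
open import Data.List
  using ([]; _∷_; [_]; _++_; length; map; upTo; applyUpTo; take; drop; filterᵇ; mapMaybe; fromMaybe)
open import Data.List.Membership.Propositional using (_∈_; find; lose)
open import Data.List.Membership.Propositional.Properties
  using (∈-map⁺; ∈-map⁻; ∈-upTo⁺; ∈-filter⁺; ∈-filter⁻; ∈-∃++)
open import Data.List.Properties
  using (++-assoc; ∷-injective; length-++; length-map; length-upTo; length-take; map-upTo;
         take++drop≡id; mapMaybe-++)
open import Data.List.Relation.Unary.All as All using (All; []; _∷_)
open import Data.List.Relation.Unary.All.Properties using (all⁺; all⁻; ¬All⇒Any¬)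
open import Data.List.Relation.Unary.Any using (here)
open import Data.List.Relation.Unary.Any.Properties using (any⁺; any⁻)
open import Data.List.Relation.Unary.Linked using (Linked; []; [-]; _∷_)
open import Data.Maybe using (Maybe; just; nothing)
open import Data.Nat
  using (zero; suc; _+_; _∸_; _<_; _≥_; _⊓_; _≤ᵇ_; _<ᵇ_; _≤′_; ≤′-refl; ≤′-step; z≤n; s≤s; s≤s⁻¹; _≤?_)
open import Data.Nat.GeneralisedArithmetic using (iterate)
open import Data.Nat.Properties
open import Algebra.Properties.CommutativeSemigroup +-commutativeSemigroup using (interchange)
open import Data.Product using (_,_; proj₁; proj₂; ∃-syntax)
open import Data.Sum using (inj₁; inj₂)
open import Data.Unit using (⊤; tt)
open import Function using (_∘_; Equivalence)
open import Relation.Binary.PropositionalEquality hiding ([_])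
open import Relation.Nullary using (¬_; ofⁿ; yes; no; contradiction)

open Equivalence using (to; from)

ind : Bool → ℕ
ind b = if b then 1 else 0

ind≤1 : ∀ b → ind b ≤ 1
ind≤1 true  = ≤-refl
ind≤1 false = z≤n

countᵇ-++ : ∀ (p : ℕ → Bool) xs ys → countᵇ p (xs ++ ys) ≡ countᵇ p xs + countᵇ p ys
countᵇ-++ p []       ys = refl
countᵇ-++ p (x ∷ xs) ys =
  trans (cong (ind (p x) +_) (countᵇ-++ p xs ys)) (sym (+-assoc (ind (p x)) _ _))

countᵇ-map : ∀ (p : ℕ → Bool) (f : ℕ → ℕ) xs → countᵇ p (map f xs) ≡ countᵇ (p ∘ f) xs
countᵇ-map p f []       = refl
countᵇ-map p f (x ∷ xs) = cong (ind (p (f x)) +_) (countᵇ-map p f xs)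

countᵇ≤length : ∀ (p : ℕ → Bool) xs → countᵇ p xs ≤ length xs
countᵇ≤length p []       = z≤n
countᵇ≤length p (x ∷ xs) = +-mono-≤ (ind≤1 (p x)) (countᵇ≤length p xs)

countᵇ-none : ∀ (p : ℕ → Bool) xs → (∀ x → ¬ T (p x)) → countᵇ p xs ≡ 0
countᵇ-none p []       _  = refl
countᵇ-none p (x ∷ xs) ¬p with p x | ¬p x
... | true  | ¬px = ⊥-elim (¬px tt)
... | false | _   = countᵇ-none p xs ¬p

countᵇ-all : ∀ (p : ℕ → Bool) {xs} → All (T ∘ p) xs → countᵇ p xs ≡ length xs
countᵇ-all p []                   = refl
countᵇ-all p {x ∷ _} (px ∷ pxs) with p x
... | true = cong suc (countᵇ-all p pxs)

countᵇ-head-pos : ∀ (p : ℕ → Bool) {x} xs → T (p x) → 0 < countᵇ p (x ∷ xs)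
countᵇ-head-pos p {x} xs px with p x
... | true = s≤s z≤n

countᵇ-first : ∀ (p : ℕ → Bool) xs {k} → suc k ≤ countᵇ p xs →
               ∃[ u ] ∃[ c ] ∃[ w ] xs ≡ u ++ c ∷ w × T (p c) × k ≤ countᵇ p w
countᵇ-first p (x ∷ xs) k< with p x in px
... | true  = [] , x , xs , refl , from T-≡ px , s≤s⁻¹ k<
... | false with countᵇ-first p xs k<
...   | u , c , w , refl , pc , k≤ = x ∷ u , c , w , refl , pc , k≤

applyUpTo-index : ∀ {A : Set} (f : ℕ → A) L u {c} w →
                  applyUpTo f L ≡ u ++ c ∷ w → c ≡ f (length u)
applyUpTo-index f (suc L) []      w eq = sym (proj₁ (∷-injective eq))
applyUpTo-index f (suc L) (_ ∷ u) w eq = applyUpTo-index (f ∘ suc) L u w (proj₂ (∷-injective eq))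

range1-index : ∀ L u {c} w → range1 L ≡ u ++ c ∷ w → c ≡ suc (length u)
range1-index L u w eq = applyUpTo-index suc L u w (trans (sym (map-upTo suc L)) eq)

length-range1 : ∀ L → length (range1 L) ≡ L
length-range1 L = trans (length-map suc (upTo L)) (length-upTo L)

range1-≤ : ∀ L u {c} w → range1 L ≡ u ++ c ∷ w → c ≤ L
range1-≤ L u {c} w eq = begin
  c                          ≡⟨ range1-index L u w eq ⟩
  suc (length u)             ≤⟨ s≤s (m≤m+n (length u) (length w)) ⟩
  suc (length u + length w)  ≡⟨ sym (+-suc (length u) (length w)) ⟩
  length u + length (c ∷ w)  ≡⟨ sym (length-++ u) ⟩
  length (u ++ c ∷ w)        ≡⟨ cong length (sym eq) ⟩
  length (range1 L)          ≡⟨ length-range1 L ⟩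
  L                          ∎
  where open ≤-Reasoning

range1-order : ∀ L u {c} u' {e} w → range1 L ≡ u ++ c ∷ u' ++ e ∷ w → c < e
range1-order L u {c} u' {e} w eq = begin-strict
  c                                ≡⟨ range1-index L u _ eq ⟩
  suc (length u)                   <⟨ s≤s (m<m+n (length u) (s≤s z≤n)) ⟩
  suc (length u + length (c ∷ u')) ≡⟨ cong suc (sym (length-++ u)) ⟩
  suc (length (u ++ c ∷ u'))       ≡⟨ sym (range1-index L (u ++ c ∷ u') w eq') ⟩
  e                                ∎
  where
  open ≤-Reasoning
  eq' : range1 L ≡ (u ++ c ∷ u') ++ e ∷ w
  eq' = trans eq (sym (++-assoc u (c ∷ u') (e ∷ w)))

drop≡⇒≡take++ : ∀ {A : Set} p (xs : List A) {u c w} →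
                drop p xs ≡ u ++ c ∷ w → xs ≡ (take p xs ++ u) ++ c ∷ w
drop≡⇒≡take++ p xs {u} {c} {w} eq = begin
  xs                         ≡⟨ take++drop≡id p xs ⟨
  take p xs ++ drop p xs     ≡⟨ cong (take p xs ++_) eq ⟩
  take p xs ++ u ++ c ∷ w    ≡⟨ ++-assoc (take p xs) u (c ∷ w) ⟨
  (take p xs ++ u) ++ c ∷ w  ∎
  where open ≡-Reasoning

range1-drop : ∀ {L p} u {c} w → p ≤ L → drop p (range1 L) ≡ u ++ c ∷ w → p < c
range1-drop {L} {p} u {c} w p≤L eq = begin-strict
  p                                       ≡⟨ length-take-p ⟨
  length (take p (range1 L))              ≤⟨ m≤m+n _ (length u) ⟩
  length (take p (range1 L)) + length u   ≡⟨ length-++ (take p (range1 L)) ⟨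
  length (take p (range1 L) ++ u)         <⟨ n<1+n _ ⟩
  suc (length (take p (range1 L) ++ u))   ≡⟨ range1-index L _ w (drop≡⇒≡take++ p (range1 L) eq) ⟨
  c                                       ∎
  where
  open ≤-Reasoning
  length-take-p : length (take p (range1 L)) ≡ p
  length-take-p = trans (length-take p (range1 L))
                        (trans (cong (p ⊓_) (length-range1 L)) (m≤n⇒m⊓n≡m p≤L))

∈-range1⁺ : ∀ {r L} → r < L → suc r ∈ range1 L
∈-range1⁺ r<L = ∈-map⁺ suc (∈-upTo⁺ r<L)

∈-range1⁻ : ∀ {r L} → r ∈ range1 L → 1 ≤ r
∈-range1⁻ r∈ with ∈-map⁻ suc r∈
... | _ , _ , refl = s≤s z≤n

range1-suc : ∀ L → range1 (suc L) ≡ 1 ∷ map suc (range1 L)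
range1-suc L = cong (λ xs → 1 ∷ map suc xs) (sym (map-upTo suc L))

countᵇ-range1-suc : ∀ (P : ℕ → Bool) L →
                    countᵇ P (range1 (suc L)) ≡ ind (P 1) + countᵇ (P ∘ suc) (range1 L)
countᵇ-range1-suc P L =
  trans (cong (countᵇ P) (range1-suc L)) (cong (ind (P 1) +_) (countᵇ-map P suc (range1 L)))

-- Being downward closed, P holds exactly on 1, …, c, where c counts its witnesses in 1, …, L.
range1-count-prefix : ∀ (P : ℕ → Bool) → (∀ i → T (P (suc (suc i))) → T (P (suc i))) →
                      ∀ L → ¬ T (P (suc L)) → ¬ T (P (suc (countᵇ P (range1 L))))
range1-count-prefix P down zero    ¬P = ¬P
range1-count-prefix P down (suc L) ¬P Pc
  with P 1 in P1 | subst (T ∘ P ∘ suc) (countᵇ-range1-suc P L) Pc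
... | true  | Pc′ = range1-count-prefix (P ∘ suc) (down ∘ suc) L ¬P Pc′
... | false | Pc′ = subst T P1 (reach-one _ Pc′)
  where
  reach-one : ∀ i → T (P (suc i)) → T (P 1)
  reach-one zero    Pi = Pi
  reach-one (suc i) Pi = reach-one i (down i Pi)

#plus #minus : List Sign → ℕ
#plus []           = 0
#plus (plus ∷ w)   = suc (#plus w)
#plus (minus ∷ w)  = #plus w
#minus []          = 0
#minus (plus ∷ w)  = #minus w
#minus (minus ∷ w) = suc (#minus w)

#plus-++ : ∀ u v → #plus (u ++ v) ≡ #plus u + #plus v
#plus-++ []          v = refl
#plus-++ (plus ∷ u)  v = cong suc (#plus-++ u v)
#plus-++ (minus ∷ u) v = #plus-++ u v

#minus-++ : ∀ u v → #minus (u ++ v) ≡ #minus u + #minus v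
#minus-++ []          v = refl
#minus-++ (plus ∷ u)  v = #minus-++ u v
#minus-++ (minus ∷ u) v = cong suc (#minus-++ u v)

Ballot : List Sign → Set
Ballot []      = ⊤
Ballot (s ∷ w) = #minus (s ∷ w) ≤ #plus (s ∷ w) × Ballot w

ballot-head : ∀ {w} → Ballot w → #minus w ≤ #plus w
ballot-head {[]}    _       = z≤n
ballot-head {_ ∷ _} (h , _) = h

ballot-suffix : ∀ u {v} → Ballot (u ++ v) → #minus v ≤ #plus v
ballot-suffix []      b       = ballot-head b
ballot-suffix (_ ∷ u) (_ , b) = ballot-suffix u b

ballot-plus : ∀ {w} → Ballot w → Ballot (plus ∷ w)
ballot-plus b = m≤n⇒m≤1+n (ballot-head b) , b

cancel1-removes-pairs : ∀ w → ∃[ d ] #plus w ≡ #plus (cancel1 w) + d × #minus w ≡ #minus (cancel1 w) + d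
cancel1-removes-pairs []          = 0 , refl , refl
cancel1-removes-pairs (plus ∷ w) with cancel1-removes-pairs w
... | d , p≡ , m≡ = d , cong suc p≡ , m≡
cancel1-removes-pairs (minus ∷ [])         = 0 , refl , refl
cancel1-removes-pairs (minus ∷ plus ∷ w)   = 1 , sym (+-comm (#plus w) 1) , sym (+-comm (#minus w) 1)
cancel1-removes-pairs (minus ∷ minus ∷ w) with cancel1-removes-pairs (minus ∷ w)
... | d , p≡ , m≡ = d , p≡ , cong suc m≡

ballot-head-cancel1⁻ : ∀ w → #minus (cancel1 w) ≤ #plus (cancel1 w) → #minus w ≤ #plus w
ballot-head-cancel1⁻ w h with cancel1-removes-pairs w
... | d , p≡ , m≡ = subst₂ _≤_ (sym m≡) (sym p≡) (+-monoˡ-≤ d h)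

ballot-cancel1⁻ : ∀ w → Ballot (cancel1 w) → Ballot w
ballot-cancel1⁻ []      _ = tt
ballot-cancel1⁻ (s ∷ w) b = ballot-head-cancel1⁻ (s ∷ w) (ballot-head b) , tail-ballot s w b
  where
  tail-ballot : ∀ s w → Ballot (cancel1 (s ∷ w)) → Ballot w
  tail-ballot plus  w             (_ , b) = ballot-cancel1⁻ w b
  tail-ballot minus []            _       = tt
  tail-ballot minus (plus ∷ w)    b       = ballot-plus b
  tail-ballot minus (minus ∷ w)   (_ , b) = ballot-cancel1⁻ (minus ∷ w) b

ballot-iterate-cancel1⁻ : ∀ k w → Ballot (iterate cancel1 w k) → Ballot w
ballot-iterate-cancel1⁻ zero    w b = b
ballot-iterate-cancel1⁻ (suc k) w b = ballot-cancel1⁻ w (ballot-iterate-cancel1⁻ k (cancel1 w) b)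

noMinus⇒ballot : ∀ {w} → NoMinus w → Ballot w
noMinus⇒ballot []           = tt
noMinus⇒ballot {_ ∷ w} (refl ∷ nm) =
  subst (_≤ suc (#plus w)) (sym (noMinus-#minus nm)) z≤n , noMinus⇒ballot nm
  where
  noMinus-#minus : ∀ {w} → NoMinus w → #minus w ≡ 0
  noMinus-#minus []          = refl
  noMinus-#minus (refl ∷ nm) = noMinus-#minus nm

reduceSig≡iterate : ∀ w → reduceSig w ≡ iterate cancel1 w (length w)
reduceSig≡iterate []      = refl
reduceSig≡iterate (s ∷ w) = trans unfold-loop (loop≗iterate (length w) (cancel1 (s ∷ w)))
  where
  -- The local loop of reduceSig cannot be named here; unification recovers it.
  loop : ℕ → List Sign → List Sign
  loop = _
  unfold-loop : reduceSig (s ∷ w) ≡ loop (length w) (cancel1 (s ∷ w))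
  unfold-loop with length w | cancel1 (s ∷ w)
  ... | _ | _ = refl
  loop≗iterate : ∀ k v → loop k v ≡ iterate cancel1 v k
  loop≗iterate zero    v = refl
  loop≗iterate (suc k) v = loop≗iterate k (cancel1 v)

reduceSig-ballot : ∀ w → NoMinus (reduceSig w) → Ballot w
reduceSig-ballot w nm =
  ballot-iterate-cancel1⁻ (length w) w (noMinus⇒ballot (subst NoMinus (reduceSig≡iterate w) nm))

pureSign : List ℕ → Bool → Bool → Maybe Sign
pureSign []      _     _     = nothing
pureSign (_ ∷ _) true  _     = just plus
pureSign (_ ∷ _) false true  = just minus
pureSign (_ ∷ _) false false = nothing

-- a i, b i: does the set in row i meet {m}, resp. {m+1}.
columnSign : (ℕ → Bool) → (ℕ → Bool) → List ℕ → Maybe Sign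
columnSign a b rows =
  let rs = filterᵇ (λ i → a i ∨ b i) rows
  in pureSign rs (all (λ i → a i ∧ not (b i)) rs) (all (λ i → not (a i) ∧ b i) rs)

colSign≡columnSign : ∀ n la (F : Filling n) m j →
  colSign n la F m j ≡ columnSign (λ i → has (F i j) m) (λ i → has (F i j) (suc m)) (colRows la j)
colSign≡columnSign n la F m j
  with filterᵇ (λ i → has (F i j) m ∨ has (F i j) (suc m)) (colRows la j)
... | []     = refl
... | r ∷ rs with all (λ i → has (F i j) m ∧ not (has (F i j) (suc m))) (r ∷ rs)
                | all (λ i → not (has (F i j) m) ∧ has (F i j) (suc m)) (r ∷ rs)
...   | true  | _     = refl
...   | false | true  = refl
...   | false | false = refl

T-not⇒¬T : ∀ {x} → T (not x) → ¬ T x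
T-not⇒¬T {false} _ ()

T-∨-¬not∧⇒T : ∀ {x y} → T (x ∨ y) → ¬ T (not x ∧ y) → T x
T-∨-¬not∧⇒T {true}             _ _  = tt
T-∨-¬not∧⇒T {false} {true}     _ ¬y = ⊥-elim (¬y tt)

module _ (a b : ℕ → Bool) (rows : List ℕ) where

  private
    meets : ℕ → Bool
    meets i = a i ∨ b i

    meeting⁺ : ∀ {r} → r ∈ rows → T (b r) → r ∈ filterᵇ meets rows
    meeting⁺ r∈ br = ∈-filter⁺ (T? ∘ meets) r∈ (from T-∨ (inj₂ br))

    meeting⁻ : ∀ {r} → r ∈ filterᵇ meets rows → r ∈ rows × T (meets r)
    meeting⁻ = ∈-filter⁻ (T? ∘ meets)

    weight-empty : ∀ {A B} → ¬ T B → ind B + 0 ≤ ind A + 0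
    weight-empty {B = false} _ = z≤n
    weight-empty {B = true}  ¬B = ⊥-elim (¬B tt)

    weight-plus : ∀ {A B} → T A → ¬ T B → ind B + 1 ≤ ind A + 0
    weight-plus {true} {false} _ _  = ≤-refl
    weight-plus {true} {true}  _ ¬B = ⊥-elim (¬B tt)

    weight-minus : ∀ A B → ind B + 0 ≤ ind A + 1
    weight-minus A B = ≤-trans (+-monoˡ-≤ 0 (ind≤1 B)) (m≤n+m 1 (ind A))

    weight-mixed : ∀ {A B} → T A → ind B + 0 ≤ ind A + 0
    weight-mixed {true} _ = +-monoˡ-≤ 0 (ind≤1 _)

  -- An m-pure column contains m but not m+1; a mixed one contains m.
  columnSign-weight :
    ind (any b rows) + #plus (fromMaybe (columnSign a b rows)) ≤
    ind (any a rows) + #minus (fromMaybe (columnSign a b rows))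
  columnSign-weight with filterᵇ (λ i → a i ∨ b i) rows in rs≡
  ... | [] = weight-empty λ B →
    let x , x∈ , bx = find (any⁻ b rows B) in contradiction (subst (x ∈_) rs≡ (meeting⁺ x∈ bx)) λ ()
  ... | r ∷ rs with all (λ i → a i ∧ not (b i)) (r ∷ rs) in pure-m
                  | all (λ i → not (a i) ∧ b i) (r ∷ rs) in pure-m+1
  ...   | true  | _     = weight-plus contains-m lacks-m+1
    where
    pure : All (λ i → T (a i ∧ not (b i))) (r ∷ rs)
    pure = all⁺ (λ i → a i ∧ not (b i)) (r ∷ rs) (from T-≡ pure-m)
    r∈rows : r ∈ rows
    r∈rows = proj₁ (meeting⁻ (subst (r ∈_) (sym rs≡) (here refl)))
    contains-m : T (any a rows)
    contains-m = any⁺ a (lose r∈rows (proj₁ (to T-∧ (All.lookup pure (here refl)))))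
    lacks-m+1 : ¬ T (any b rows)
    lacks-m+1 B =
      let x , x∈ , bx = find (any⁻ b rows B)
          x∈rs = subst (x ∈_) rs≡ (meeting⁺ x∈ bx)
      in T-not⇒¬T (proj₂ (to T-∧ (All.lookup pure x∈rs))) bx
  ...   | false | true  = weight-minus (any a rows) (any b rows)
  ...   | false | false =
    let z , z∈ , ¬pure = find (¬All⇒Any¬ (T? ∘ λ i → not (a i) ∧ b i) (r ∷ rs) not-pure)
        z∈rows , meets-z = meeting⁻ (subst (z ∈_) (sym rs≡) z∈)
    in weight-mixed (any⁺ a (lose z∈rows (T-∨-¬not∧⇒T meets-z ¬pure)))
    where
    not-pure : ¬ All (λ i → T (not (a i) ∧ b i)) (r ∷ rs)
    not-pure ps = subst T pure-m+1 (all⁻ (λ i → not (a i) ∧ b i) ps)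

mapMaybe-∷ : ∀ {A B : Set} (f : A → Maybe B) x xs →
             mapMaybe f (x ∷ xs) ≡ fromMaybe (f x) ++ mapMaybe f xs
mapMaybe-∷ f x xs with f x
... | just _  = refl
... | nothing = refl

signs-weight : ∀ (p q : ℕ → Bool) (f : ℕ → Maybe Sign) →
  (∀ x → ind (q x) + #plus (fromMaybe (f x)) ≤ ind (p x) + #minus (fromMaybe (f x))) →
  ∀ xs → countᵇ q xs + #plus (mapMaybe f xs) ≤ countᵇ p xs + #minus (mapMaybe f xs)
signs-weight p q f weight []       = z≤n
signs-weight p q f weight (x ∷ xs) = begin
  countᵇ q (x ∷ xs) + #plus (mapMaybe f (x ∷ xs))                 ≡⟨ split q #plus #plus-++ ⟩
  (ind (q x) + #plus (fromMaybe (f x))) + (countᵇ q xs + #plus (mapMaybe f xs))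
    ≤⟨ +-mono-≤ (weight x) (signs-weight p q f weight xs) ⟩
  (ind (p x) + #minus (fromMaybe (f x))) + (countᵇ p xs + #minus (mapMaybe f xs))
    ≡⟨ split p #minus #minus-++ ⟨
  countᵇ p (x ∷ xs) + #minus (mapMaybe f (x ∷ xs))                ∎
  where
  open ≤-Reasoning
  split : ∀ (c : ℕ → Bool) (#s : List Sign → ℕ) → (∀ u v → #s (u ++ v) ≡ #s u + #s v) →
          countᵇ c (x ∷ xs) + #s (mapMaybe f (x ∷ xs)) ≡
          (ind (c x) + #s (fromMaybe (f x))) + (countᵇ c xs + #s (mapMaybe f xs))
  split c #s #s-++ = begin-equality
    countᵇ c (x ∷ xs) + #s (mapMaybe f (x ∷ xs))
      ≡⟨ cong (λ w → countᵇ c (x ∷ xs) + #s w) (mapMaybe-∷ f x xs) ⟩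
    (ind (c x) + countᵇ c xs) + #s (fromMaybe (f x) ++ mapMaybe f xs)
      ≡⟨ cong (ind (c x) + countᵇ c xs +_) (#s-++ (fromMaybe (f x)) (mapMaybe f xs)) ⟩
    (ind (c x) + countᵇ c xs) + (#s (fromMaybe (f x)) + #s (mapMaybe f xs))
      ≡⟨ interchange (ind (c x)) (countᵇ c xs) _ _ ⟩
    (ind (c x) + #s (fromMaybe (f x))) + (countᵇ c xs + #s (mapMaybe f xs)) ∎

part-step : ∀ {la} → Linked _≥_ la → ∀ k → part la (suc (suc k)) ≤ part la (suc k)
part-step []        _       = z≤n
part-step [-]       _       = z≤n
part-step (y≤x ∷ _) zero    = y≤x
part-step (_ ∷ la↓) (suc k) = part-step la↓ k

part-antitone : ∀ {la} → Linked _≥_ la → ∀ {a b} → 1 ≤ a → a ≤ b → part la b ≤ part la a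
part-antitone {la} la↓ {a} 1≤a a≤b = go (≤⇒≤′ a≤b)
  where
  go : ∀ {b} → a ≤′ b → part la b ≤ part la a
  go ≤′-refl                        = ≤-refl
  go (≤′-step {zero}  a≤′0)         = contradiction (≤-trans 1≤a (≤′⇒≤ a≤′0)) λ ()
  go (≤′-step {suc b} a≤′b)         = ≤-trans (part-step la↓ b) (go a≤′b)

part-beyond : ∀ la i → length la < i → part la i ≡ 0
part-beyond []       _             _          = refl
part-beyond (_ ∷ la) (suc (suc i)) (s≤s len<) = part-beyond la (suc i) len<

part-pos⇒≤length : ∀ la r → 0 < part la r → r ≤ length la
part-pos⇒≤length la r pos = ≮⇒≥ λ len<r → <-irrefl refl (subst (0 <_) (part-beyond la r len<r) pos)

flat-beyond : ∀ la i → length la ≤ i → flat la (suc i) ≡ 0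
flat-beyond la zero    len≤ = part-beyond la 1 (s≤s len≤)
flat-beyond la (suc i) len≤ rewrite part-beyond la (suc (suc i)) (s≤s len≤) = ⊓-zeroʳ _

flat-pos-step : ∀ la i → 0 < flat la (suc (suc i)) → 0 < flat la (suc i)
flat-pos-step la i pos with flat la (suc i) | pos
... | suc _ | _  = s≤s z≤n
... | zero  | ()

flat-bound : ∀ la i → ∃[ r ] 1 ≤ r × r ≤ suc i × part la r + (r ∸ 1) ≤ flat la (suc i) + i
flat-bound la zero = 1 , ≤-refl , ≤-refl , ≤-refl
flat-bound la (suc i) with ≤-total (flat la (suc i) ∸ 1) (part la (suc (suc i)))
... | inj₂ part≤ rewrite m≥n⇒m⊓n≡n part≤ = suc (suc i) , s≤s z≤n , ≤-refl , ≤-refl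
... | inj₁ ∸1≤ rewrite m≤n⇒m⊓n≡m ∸1≤ =
  let r , 1≤r , r≤ , bound = flat-bound la i
  in r , 1≤r , m≤n⇒m≤1+n r≤ , ≤-trans bound (shift (flat la (suc i)))
  where
  shift : ∀ f → f + i ≤ (f ∸ 1) + suc i
  shift f = begin
    f + i               ≤⟨ +-monoˡ-≤ i (m≤n+m∸n f 1) ⟩
    suc ((f ∸ 1) + i)   ≡⟨ +-suc (f ∸ 1) i ⟨
    (f ∸ 1) + suc i     ∎
    where open ≤-Reasoning

flat-kflat : ∀ la → flat la (suc (kflat la)) ≡ 0
flat-kflat la = ¬pos⇒≡0 (range1-count-prefix (λ i → 0 <ᵇ flat la i) down (length la) beyond)
  where
  ¬pos⇒≡0 : ∀ {x} → ¬ T (0 <ᵇ x) → x ≡ 0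
  ¬pos⇒≡0 {zero}  _    = refl
  ¬pos⇒≡0 {suc _} ¬pos = ⊥-elim (¬pos tt)
  down : ∀ i → T (0 <ᵇ flat la (suc (suc i))) → T (0 <ᵇ flat la (suc i))
  down i pos = <⇒<ᵇ (flat-pos-step la i (<ᵇ⇒< 0 _ pos))
  beyond : ¬ T (0 <ᵇ flat la (suc (length la)))
  beyond pos = subst (λ x → T (0 <ᵇ x)) (flat-beyond la (length la) ≤-refl) pos

barλ-bound : ∀ n la i → 1 ≤ i → i ≤ n → ∃[ r ] 1 ≤ r × r ≤ i × part la r + (r ∸ 1) ≤ barλ n la i
barλ-bound n la (suc i) _ i<n with suc i ≤ᵇ n | ≤⇒≤ᵇ i<n
... | true | _ with n ≤ᵇ kflat la
...   | true  = flat-bound la i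
...   | false with suc i ≤ᵇ kflat la | ≤ᵇ-reflects-≤ (suc i) (kflat la)
...     | true  | _        = flat-bound la i
...     | false | ofⁿ i≰k  =
  let r , 1≤r , r≤ , bound = flat-bound la (kflat la)
  in r , 1≤r , ≤-trans r≤ (≰⇒> i≰k) , subst (λ f → part la r + (r ∸ 1) ≤ f + kflat la) (flat-kflat la) bound

has-zero : ∀ {n} (S : Subset n) → ¬ T (has S 0)
has-zero []      ()
has-zero (_ ∷ _) ()

has⇒≤ : ∀ {n} (S : Subset n) k → T (has S k) → k ≤ n
has⇒≤ []      _             ()
has⇒≤ (_ ∷ _) zero          ()
has⇒≤ (_ ∷ _) (suc zero)    _  = s≤s z≤n
has⇒≤ (_ ∷ S) (suc (suc k)) h  = s≤s (has⇒≤ S (suc k) h)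

≤set-trans : ∀ {n} (A B C : Subset n) → NonemptySet B → A ≤set B → B ≤set C → A ≤set C
≤set-trans _ _ _ (k , k∈B) A≤B B≤C x y x∈A y∈C = ≤-trans (A≤B x k x∈A k∈B) (B≤C k y k∈B y∈C)

<-chain : ∀ (R : ℕ → ℕ → Set) (Ok : ℕ → Set) →
          (∀ {x y z} → Ok y → R x y → R y z → R x z) →
          (∀ {x} → Ok x → Ok (suc x) → R x (suc x)) →
          ∀ {x y} → x < y → (∀ {z} → x ≤ z → z ≤ y → Ok z) → R x y
<-chain R Ok R-trans R-step {x} x<y ok = go (≤⇒≤′ x<y) ok
  where
  go : ∀ {y} → suc x ≤′ y → (∀ {z} → x ≤ z → z ≤ y → Ok z) → R x y
  go ≤′-refl             ok = R-step (ok ≤-refl (n≤1+n x)) (ok (n≤1+n x) ≤-refl)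
  go (≤′-step {y} x<′y) ok =
    R-trans (ok x≤y (n≤1+n y))
            (go x<′y λ x≤z z≤y → ok x≤z (m≤n⇒m≤1+n z≤y))
            (R-step (ok x≤y (n≤1+n y)) (ok (m≤n⇒m≤1+n x≤y) ≤-refl))
    where
    x≤y : x ≤ y
    x≤y = <⇒≤ (≤′⇒≤ x<′y)

module _ {la n} (F : Filling n) (la↓ : Linked _≥_ la) (F-svrpp : IsSVRPP n la F) where

  private
    nonempty = proj₁ F-svrpp
    row-step = proj₁ (proj₂ F-svrpp)
    col-step = proj₂ (proj₂ F-svrpp)

  row-≤set : ∀ {i c e} → c < e → InDiag la i c → InDiag la i e → F i c ≤set F i e
  row-≤set {i} c<e (1≤i , 1≤c , _) (_ , _ , e≤) =
    <-chain (λ c e → F i c ≤set F i e) (InDiag la i)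
            (λ {x y z} ok → ≤set-trans (F i x) (F i y) (F i z) (nonempty i y ok)) (λ {x} → row-step i x) c<e
            (λ c≤z z≤e → 1≤i , ≤-trans 1≤c c≤z , ≤-trans z≤e e≤)

  col-≤set : ∀ {s t c} → s < t → InDiag la s c → InDiag la t c → F s c ≤set F t c
  col-≤set {c = c} s<t (1≤s , 1≤c , _) (_ , _ , c≤) =
    <-chain (λ s t → F s c ≤set F t c) (λ i → InDiag la i c)
            (λ {x y z} ok → ≤set-trans (F x c) (F y c) (F z c) (nonempty y c ok)) (λ {x} → col-step x c) s<t
            (λ s≤z z≤t → ≤-trans 1≤s s≤z , 1≤c , ≤-trans c≤ (part-antitone la↓ (≤-trans 1≤s s≤z) z≤t))

  ≤set-southeast : ∀ {s c t e} → c < e → s ≤ t → InDiag la s c → InDiag la t e → F s c ≤set F t e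
  ≤set-southeast {s} {c} {t} {e} c<e s≤t dsc@(1≤s , 1≤c , _) dte@(_ , _ , e≤) with m≤n⇒m<n∨m≡n s≤t
  ... | inj₂ refl = row-≤set c<e dsc dte
  ... | inj₁ s<t  = ≤set-trans (F s c) (F s e) (F t e) (nonempty s e dse) (row-≤set c<e dsc dse) (col-≤set s<t dse dte)
    where
    dse : InDiag la s e
    dse = 1≤s , ≤-trans 1≤c (<⇒≤ c<e) , ≤-trans e≤ (part-antitone la↓ 1≤s s≤t)

module Columns (la : List ℕ) {n} (F : Filling n) where

  cols : List ℕ
  cols = range1 (part la 1)

  colHas : ℕ → ℕ → Bool
  colHas i j = any (λ r → has (F r j) i) (colRows la j)

  colHas⁻ : ∀ {i j} → 1 ≤ j → T (colHas i j) → ∃[ r ] InDiag la r j × T (has (F r j) i)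
  colHas⁻ {i} {j} 1≤j h with find (any⁻ _ (colRows la j) h)
  ... | r , r∈ , hr with ∈-filter⁻ (T? ∘ λ r → j ≤ᵇ part la r) {xs = range1 (length la)} r∈
  ...   | r∈rows , j≤ = r , (∈-range1⁻ r∈rows , 1≤j , ≤ᵇ⇒≤ j (part la r) j≤) , hr

  colHas⁺ : ∀ {i r j} → InDiag la r j → T (has (F r j) i) → T (colHas i j)
  colHas⁺ {r = suc r} {j} (_ , 1≤j , j≤) h =
    any⁺ _ (lose (∈-filter⁺ (T? ∘ λ r → j ≤ᵇ part la r) (∈-range1⁺ r<len) (≤⇒≤ᵇ j≤)) h)
    where
    r<len : r < length la
    r<len = part-pos⇒≤length la (suc r) (≤-trans 1≤j j≤)

  ircont-absent : ∀ {i} → (∀ (S : Subset n) → ¬ T (has S i)) → ircont n la F i ≡ 0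
  ircont-absent absent = countᵇ-none _ cols λ j h →
    let r , _ , hr = find (any⁻ _ (colRows la j) h) in absent (F r j) hr

  module _ (F-hw : HighestWeight n la F) where

    colHas-ballot : ∀ {m} → 1 ≤ m → m < n → ∀ u v → cols ≡ u ++ v →
                    countᵇ (colHas (suc m)) v ≤ countᵇ (colHas m) v
    colHas-ballot {m} 1≤m m<n u v cols≡ = +-cancelʳ-≤ (#plus signs) _ _ (begin
      countᵇ (colHas (suc m)) v + #plus signs   ≤⟨ signs-weight (colHas m) (colHas (suc m)) f column-weight v ⟩
      countᵇ (colHas m) v + #minus signs        ≤⟨ +-monoʳ-≤ _ (ballot-suffix (mapMaybe f u) ballot) ⟩
      countᵇ (colHas m) v + #plus signs         ∎)
      where
      open ≤-Reasoning
      f : ℕ → Maybe Sign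
      f = colSign n la F m
      signs : List Sign
      signs = mapMaybe f v
      column-weight : ∀ j → ind (colHas (suc m) j) + #plus (fromMaybe (f j)) ≤
                            ind (colHas m j) + #minus (fromMaybe (f j))
      column-weight j rewrite colSign≡columnSign n la F m j = columnSign-weight _ _ (colRows la j)
      ballot : Ballot (mapMaybe f u ++ signs)
      ballot = subst Ballot (trans (cong (mapMaybe f) cols≡) (mapMaybe-++ f u v))
                     (reduceSig-ballot _ (F-hw m 1≤m m<n))

    colHas-antitone : ∀ {a b} → 1 ≤ b → b ≤ a → a ≤ n → ∀ u v → cols ≡ u ++ v →
                      countᵇ (colHas a) v ≤ countᵇ (colHas b) v
    colHas-antitone {b = b} 1≤b b≤a a≤n u v cols≡ = go (≤⇒≤′ b≤a) a≤n
      where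
      go : ∀ {a} → b ≤′ a → a ≤ n → countᵇ (colHas a) v ≤ countᵇ (colHas b) v
      go ≤′-refl           _   = ≤-refl
      go (≤′-step b≤′a) a<n =
        ≤-trans (colHas-ballot (≤-trans 1≤b (≤′⇒≤ b≤′a)) a<n u v cols≡) (go b≤′a (<⇒≤ a<n))

    module _ (la↓ : Linked _≥_ la) (F-svrpp : IsSVRPP n la F) where

      row-bound : ∀ i {u c w s k} → cols ≡ u ++ c ∷ w → InDiag la s c → T (has (F s c) i) →
                  k < i → k ≤ countᵇ (colHas i) w → k < s
      row-bound _             {k = zero}  _ (1≤s , _) _ _ _ = 1≤s
      row-bound (suc zero)    {k = suc _} _ _ _ (s≤s ()) _
      row-bound (suc (suc m)) {u} {c} {w} {s} {suc k} cols≡ dsc has-s (s≤s k<i) k<count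
        with countᵇ-first (colHas (suc m)) w
               (≤-trans k<count (colHas-ballot (s≤s z≤n) (has⇒≤ (F s c) _ has-s) (u ++ [ c ]) w
                                               (trans cols≡ (sym (++-assoc u [ c ] w)))))
      ... | u′ , e , w′ , refl , e-has , k≤ =
        let t , dte , has-t = colHas⁻ (≤-trans (s≤s z≤n) c<e) e-has
            cols≡′ = trans cols≡ (sym (++-assoc u (c ∷ u′) (e ∷ w′)))
        in ≤-trans (s≤s (row-bound (suc m) cols≡′ dte has-t k<i k≤)) (above dte has-t)
        where
        c<e : c < e
        c<e = range1-order _ u u′ w′ cols≡
        above : ∀ {t} → InDiag la t e → T (has (F t e) (suc m)) → t < s
        above dte has-t = ≰⇒> λ s≤t →
          1+n≰n (≤set-southeast F la↓ F-svrpp c<e s≤t dsc dte _ _ (to T-≡ has-s) (to T-≡ has-t))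

      ircont-≤ : ∀ {i r} → 1 ≤ r → r ≤ i → ircont n la F i ≤ part la r + (r ∸ 1)
      ircont-≤ {i} {suc r} _ r<i = begin
        countᵇ (colHas i) cols
          ≡⟨ cong (countᵇ (colHas i)) (take++drop≡id p cols) ⟨
        countᵇ (colHas i) (take p cols ++ drop p cols)
          ≡⟨ countᵇ-++ (colHas i) (take p cols) (drop p cols) ⟩
        countᵇ (colHas i) (take p cols) + countᵇ (colHas i) (drop p cols)
          ≤⟨ +-mono-≤ left right ⟩
        p + r ∎
        where
        open ≤-Reasoning
        p : ℕ
        p = part la (suc r)
        left : countᵇ (colHas i) (take p cols) ≤ p
        left = ≤-trans (countᵇ≤length _ (take p cols))
                       (≤-trans (≤-reflexive (length-take p cols)) (m⊓n≤m p _))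
        right : countᵇ (colHas i) (drop p cols) ≤ r
        right = ≮⇒≥ λ r<count →
          let u , c , w , drop≡ , c-has , r≤ = countᵇ-first (colHas i) (drop p cols) r<count
              p<c = range1-drop u w (part-antitone la↓ ≤-refl (s≤s z≤n)) drop≡
              s , dsc , has-s = colHas⁻ (≤-trans (s≤s z≤n) p<c) c-has
              r<s = row-bound i (drop≡⇒≡take++ p cols drop≡) dsc has-s r<i r≤
              c≤p = ≤-trans (proj₂ (proj₂ dsc)) (part-antitone la↓ (s≤s z≤n) r<s)
          in <-irrefl refl (<-≤-trans p<c c≤p)

      colHas-one : ∀ {j} → j ∈ cols → T (colHas 1 j)
      colHas-one {j} j∈ with ∈-∃++ j∈
      ... | u , w , cols≡ = top-entry (proj₁ F-svrpp 1 j d1j)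
        where
        d1j : InDiag la 1 j
        d1j = s≤s z≤n , subst (1 ≤_) (sym (range1-index _ u w cols≡)) (s≤s z≤n) , range1-≤ _ u w cols≡
        -- an entry a ≥ 2 in box (1, j) forces a 1 in column j or strictly to its right,
        -- and a 1 strictly to the right would lie south-east of a
        top-entry : NonemptySet (F 1 j) → T (colHas 1 j)
        top-entry (zero , h)        = ⊥-elim (has-zero (F 1 j) (from T-≡ h))
        top-entry (suc zero , h)    = colHas⁺ d1j (from T-≡ h)
        top-entry (suc (suc a) , h)
          with countᵇ-first (colHas 1) (j ∷ w)
                 (≤-trans (countᵇ-head-pos (colHas (suc (suc a))) w (colHas⁺ d1j (from T-≡ h)))
                          (colHas-antitone ≤-refl (s≤s z≤n) (has⇒≤ (F 1 j) _ (from T-≡ h)) u (j ∷ w) cols≡))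
        ... | [] , _ , _ , j∷w≡ , e-has , _ = subst (T ∘ colHas 1) (sym (proj₁ (∷-injective j∷w≡))) e-has
        ... | _ ∷ u′ , e , w′ , j∷w≡ , e-has , _ =
          let t , dte , has-t = colHas⁻ (≤-trans (s≤s z≤n) j<e) e-has
          in contradiction (≤set-southeast F la↓ F-svrpp j<e (proj₁ dte) d1j dte _ _ h (to T-≡ has-t)) λ { (s≤s ()) }
          where
          j<e : j < e
          j<e = range1-order _ u u′ w′ (subst (λ w → cols ≡ u ++ j ∷ w) (proj₂ (∷-injective j∷w≡)) cols≡)

      ircont-first-row : oneRow la ⊆ₚ ircont n la F
      ircont-first-row zero          = z≤n
      ircont-first-row (suc zero)    =
        ≤-reflexive (sym (trans (countᵇ-all (colHas 1) (All.tabulate colHas-one)) (length-range1 (part la 1))))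
      ircont-first-row (suc (suc _)) = z≤n

      ircont-⊆-barλ : ircont n la F ⊆ₚ barλ n la
      ircont-⊆-barλ zero = subst (_≤ barλ n la 0) (sym (ircont-absent has-zero)) z≤n
      ircont-⊆-barλ (suc i) with suc i ≤? n
      ... | no  i≮n = subst (_≤ barλ n la (suc i)) (sym (ircont-absent λ S h → i≮n (has⇒≤ S _ h))) z≤n
      ... | yes i<n =
        let r , 1≤r , r≤ , bound = barλ-bound n la (suc i) (s≤s z≤n) i<n
        in ≤-trans (ircont-≤ 1≤r r≤) bound

lemma4p6 : (la : List ℕ) → IsPartition la → (n : ℕ) → 1 ≤ n →
           (T : Filling n) → IsSVRPP n la T → HighestWeight n la T →
           (oneRow la ⊆ₚ ircont n la T) × (ircont n la T ⊆ₚ barλ n la)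
lemma4p6 la (la↓ , _) n _ T T-svrpp T-hw =
  ircont-first-row T-hw la↓ T-svrpp , ircont-⊆-barλ T-hw la↓ T-svrpp
  where open Columns la T
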